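{- Let $k$ and $j$ be positive integers. For nonnegative integers $a_1,\dots,a_k$ with $\sum_i i a_i=k$ put $$N'(a_1,\dots,a_k)=\frac{k!}{1!^{a_1}a_1!\,2!^{a_2}a_2!\cdots k!^{a_k}a_k!}.$$ Then $$\sum_{\substack{\sum_i i a_i=k\\ a_{j+1}=\cdots=a_k=0}} N'(a_1,\dots,a_k)\,1!^{a_1}2!^{a_2}\cdots k!^{a_k}\,(-1)^{a_1+\cdots+a_k-1}(a_1+\cdots+a_k-1)! = (k-1)!\bigl(1-(j+1)\,1_{(j+1)\mid k}\bigr),$$ where the sum is over tuples $(a_1,\dots,a_k)$ of nonnegative integers.
   Context: $1_S$ denotes $1$ if the statement $S$ is true and $0$ otherwise. $N'(a_1,\dots,a_k)$ is the number of set partitions of $\{1,\dots,k\}$ with exactly $a_i$ blocks of size $i$. -}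

module Defs where

open import Data.Nat using (ℕ; zero; suc; _+_; _*_; _∸_; _^_; _≤_; _<_; NonZero; _/_; _≡ᵇ_; _<ᵇ_)
open import Data.Nat.Properties using (m*n≢0; m^n≢0)
open import Data.Nat.Combinatorics using ()
open import Data.Nat.Base using (_!)
open import Data.Nat.Properties using (_!≢0)
open import Data.Nat.Divisibility using (_∣?_)
open import Data.Fin using (Fin; toℕ)
open import Data.Vec using (Vec; []; _∷_; lookup; tabulate; sum; toList)
open import Data.List using (List; concatMap; map; allFin) renaming ([] to []ₗ; _∷_ to _∷ₗ_)
open import Data.List.Base using (upTo)
open import Data.Bool using (Bool; true; false; if_then_else_; _∧_; T)
open import Data.Integer as ℤ using (ℤ)
open import Relation.Nullary.Decidable using (does)
import Data.List as L

product : {n : ℕ} → Vec ℕ n → ℕ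
product []       = 1
product (x ∷ xs) = x * product xs

-- The (block size) of the i-th coordinate (i : Fin k) is  suc (toℕ i),
-- so a tuple (a_1,…,a_k) is a  Vec ℕ k  with  a_{s} = lookup a (s-1).

tuples : (n b : ℕ) → List (Vec ℕ n)
tuples zero    b = [] ∷ₗ []ₗ
tuples (suc n) b = concatMap (λ x → map (x ∷_) (tuples n b)) (upTo (suc b))

weight : {k : ℕ} → Vec ℕ k → ℕ
weight {k} a = sum (tabulate λ (i : Fin k) → suc (toℕ i) * lookup a i)

numBlocks : {k : ℕ} → Vec ℕ k → ℕ
numBlocks a = sum a

factPow : {k : ℕ} → Vec ℕ k → ℕ
factPow {k} a = product (tabulate λ (i : Fin k) → (suc (toℕ i) !) ^ lookup a i)

denom : {k : ℕ} → Vec ℕ k → ℕ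
denom {k} a = product (tabulate λ (i : Fin k) → ((suc (toℕ i) !) ^ lookup a i) * (lookup a i !))

product-tabulate-nonZero : ∀ {n} (f : Fin n → ℕ) → (∀ i → NonZero (f i)) → NonZero (product (tabulate f))
product-tabulate-nonZero {zero}  f h = _
product-tabulate-nonZero {suc n} f h =
  m*n≢0 (f Fin.zero) (product (tabulate (λ i → f (Fin.suc i))))
    {{h Fin.zero}} {{product-tabulate-nonZero (λ i → f (Fin.suc i)) (λ i → h (Fin.suc i))}}
  where import Data.Fin as Fin

denom-nonZero : {k : ℕ} (a : Vec ℕ k) → NonZero (denom a)
denom-nonZero {k} a = product-tabulate-nonZero _ λ i →
  m*n≢0 _ _ {{m^n≢0 (suc (toℕ i) !) (lookup a i) {{suc (toℕ i) !≢0}}}} {{lookup a i !≢0}}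

N' : {k : ℕ} → Vec ℕ k → ℕ
N' {k} a = _/_ (k !) (denom a) {{denom-nonZero a}}

zeroAbove : {k : ℕ} → ℕ → Vec ℕ k → Bool
zeroAbove {k} j a = L.foldr _∧_ true (map (λ (i : Fin k) → if j <ᵇ suc (toℕ i) then lookup a i ≡ᵇ 0 else true) (allFin k))

inRange : (k j : ℕ) → Vec ℕ k → Bool
inRange k j a = (weight a ≡ᵇ k) ∧ zeroAbove j a

summand : {k : ℕ} → Vec ℕ k → ℤ
summand a = ℤ.+ (N' a * factPow a) ℤ.* ((ℤ.- ℤ.+ 1) ℤ.^ (numBlocks a ∸ 1)) ℤ.* ℤ.+ ((numBlocks a ∸ 1) !)

-- The left-hand side. Every admissible tuple has entries ≤ k (since i a_i ≤ k),
-- so it suffices to range over tuples with entries in {0,…,k}.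
LHS : (k j : ℕ) → ℤ
LHS k j = L.foldr ℤ._+_ (ℤ.+ 0) (map (λ a → if inRange k j a then summand a else ℤ.+ 0) (tuples k k))

module Submission where

-- A block type a (a_s blocks of size s, Σ s a_s = k, m = Σ a_s blocks) has
-- N'(a) Π s!^{a_s} = k! / Π a_s! = (k!/m!) M(a), where M(a) = m!/Π a_s! counts the
-- compositions of k (ordered sequences of parts) of type a.  The weighted Pascal rule
-- m Σ_s [a_s > 0] s M(a - e_s) = k M(a) removes the factor 1/m: each summand equals
--   (k-1)! Σ_s [a_s > 0] s (-1)^{m-1} M(a - e_s).
-- Sorting the types by the removed block, the whole sum becomes
--   (k-1)! Σ_{s=1}^{min(j,k)} s E(k-s),
-- where E(n) = Σ_{types of weight n, parts ≤ j} (-1)^m M is the signed number of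
-- compositions of n into parts ≤ j.  Pascal's rule gives E(0) = 1 and
-- E(n) = - Σ_{s=1}^{min(j,n)} E(n-s), the recurrence of the coefficients ε(n) of
-- 1/(1 + x + ⋯ + x^j) = (1-x)/(1-x^{j+1}), i.e. ε(n) = d(n) - d(n-1), d(n) = [j+1 ∣ n].
-- A last induction evaluates Σ_s s ε(k-s) = 1 - (j+1) d(k).

module Binomial where

  open import Data.Nat
  open import Data.Nat.Properties
  open import Data.Nat.Divisibility
  open import Data.Nat.Tactic.RingSolver using (solve-∀)
  open import Relation.Binary.PropositionalEquality
  open ≡-Reasoning

  -- binom x y is the binomial coefficient (x+y choose x), given by Pascal's rule.
  binom : ℕ → ℕ → ℕ
  binom zero    y       = 1
  binom (suc x) zero    = 1
  binom (suc x) (suc y) = binom x (suc y) + binom (suc x) y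

  binom-factorials : ∀ x y → binom x y * (x ! * y !) ≡ (x + y) !
  binom-factorials zero y = trans (*-identityˡ _) (*-identityˡ _)
  binom-factorials (suc x) zero rewrite +-identityʳ x = trans (*-identityˡ _) (*-identityʳ _)
  binom-factorials (suc x) (suc y) = begin
    (binom x (suc y) + binom (suc x) y) * ((suc x * x !) * (suc y * y !))
      ≡⟨ split x y (binom x (suc y)) (binom (suc x) y) (x !) (y !) ⟩
    suc x * (binom x (suc y) * (x ! * (suc y * y !))) + suc y * (binom (suc x) y * ((suc x * x !) * y !))
      ≡⟨ cong₂ (λ u v → suc x * u + suc y * v) (binom-factorials x (suc y)) (binom-factorials (suc x) y) ⟩
    suc x * (x + suc y) ! + suc y * (suc x + y) !
      ≡⟨ cong (λ n → suc x * (x + suc y) ! + suc y * n !) (sym (+-suc x y)) ⟩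
    suc x * (x + suc y) ! + suc y * (x + suc y) !
      ≡⟨ sym (*-distribʳ-+ ((x + suc y) !) (suc x) (suc y)) ⟩
    (suc x + suc y) * (x + suc y) ! ∎
    where
    split : ∀ x y b c X Y → (b + c) * ((suc x * X) * (suc y * Y))
                          ≡ suc x * (b * (X * (suc y * Y))) + suc y * (c * ((suc x * X) * Y))
    split = solve-∀

  binom-raiseˡ : ∀ x y → (suc x + y) * binom x y ≡ suc x * binom (suc x) y
  binom-raiseˡ x y = *-cancelʳ-≡ _ _ (x ! * y !) {{x !* y !≢0}} (begin
    (suc x + y) * binom x y * (x ! * y !)   ≡⟨ *-assoc (suc x + y) (binom x y) (x ! * y !) ⟩
    (suc x + y) * (binom x y * (x ! * y !)) ≡⟨ cong ((suc x + y) *_) (binom-factorials x y) ⟩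
    (suc x + y) !                            ≡⟨ sym (binom-factorials (suc x) y) ⟩
    binom (suc x) y * (suc x * x ! * y !)   ≡⟨ regroup x (binom (suc x) y) (x !) (y !) ⟩
    suc x * binom (suc x) y * (x ! * y !)   ∎)
    where
    regroup : ∀ x b X Y → b * (suc x * X * Y) ≡ suc x * b * (X * Y)
    regroup = solve-∀

  binom-raiseʳ : ∀ x y → (x + suc y) * binom x y ≡ suc y * binom x (suc y)
  binom-raiseʳ x y = *-cancelʳ-≡ _ _ (x ! * y !) {{x !* y !≢0}} (begin
    (x + suc y) * binom x y * (x ! * y !)   ≡⟨ *-assoc (x + suc y) (binom x y) (x ! * y !) ⟩
    (x + suc y) * (binom x y * (x ! * y !)) ≡⟨ cong ((x + suc y) *_) (binom-factorials x y) ⟩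
    (x + suc y) * (x + y) !                  ≡⟨ cong (λ n → n * (x + y) !) (+-suc x y) ⟩
    suc (x + y) !                            ≡⟨ cong _! (sym (+-suc x y)) ⟩
    (x + suc y) !                            ≡⟨ sym (binom-factorials x (suc y)) ⟩
    binom x (suc y) * (x ! * (suc y * y !)) ≡⟨ regroup y (binom x (suc y)) (x !) (y !) ⟩
    suc y * binom x (suc y) * (x ! * y !)   ∎)
    where
    regroup : ∀ y b X Y → b * (X * (suc y * Y)) ≡ suc y * b * (X * Y)
    regroup = solve-∀

  -- (p!)^x x! divides (p x)!: splitting p x points into x unlabelled blocks of size p
  -- can be done in an integral number of ways.  Induction on x: the last block is
  -- chosen among the remaining P x + P points, and contains the first of them.
  factorial-power-divides : ∀ p x → (suc p !) ^ x * x ! ∣ (suc p * x) !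
  factorial-power-divides p zero rewrite *-zeroʳ p = divides 1 refl
  factorial-power-divides p (suc x) =
    subst₂ _∣_ lhs rhs (∣n⇒∣m*n (binom (P * x) p) (*-monoˡ-∣ (suc x * P !) (factorial-power-divides p x)))
    where
    P = suc p
    lastBlock : P * suc x ≡ P * x + P
    lastBlock = trans (*-suc P x) (+-comm P (P * x))
    binom-last : suc x * binom (P * x) p ≡ binom (P * x) P
    binom-last = *-cancelˡ-≡ _ _ P (begin
      P * (suc x * binom (P * x) p) ≡⟨ sym (*-assoc P (suc x) (binom (P * x) p)) ⟩
      P * suc x * binom (P * x) p   ≡⟨ cong (_* binom (P * x) p) lastBlock ⟩
      (P * x + P) * binom (P * x) p ≡⟨ binom-raiseʳ (P * x) p ⟩
      P * binom (P * x) P           ∎)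
    lhs : (P !) ^ x * x ! * (suc x * P !) ≡ (P !) ^ suc x * suc x !
    lhs = regroup x ((P !) ^ x) (x !) (P !)
      where
      regroup : ∀ x G X F → G * X * (suc x * F) ≡ F * G * (suc x * X)
      regroup = solve-∀
    rhs : binom (P * x) p * ((P * x) ! * (suc x * P !)) ≡ (P * suc x) !
    rhs = begin
      binom (P * x) p * ((P * x) ! * (suc x * P !)) ≡⟨ regroup x (binom (P * x) p) ((P * x) !) (P !) ⟩
      suc x * binom (P * x) p * ((P * x) ! * P !)   ≡⟨ cong (_* ((P * x) ! * P !)) binom-last ⟩
      binom (P * x) P * ((P * x) ! * P !)           ≡⟨ binom-factorials (P * x) P ⟩
      (P * x + P) !                                 ≡⟨ cong _! (sym lastBlock) ⟩
      (P * suc x) !                                 ∎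
      where
      regroup : ∀ x b Y F → b * (Y * (suc x * F)) ≡ (suc x * b) * (Y * F)
      regroup = solve-∀

module Comparisons where

  open import Data.Nat
  open import Data.Nat.Properties
  open import Data.Bool using (true; false; not; _∧_; T)
  open import Data.Empty using (⊥-elim)
  open import Relation.Binary.PropositionalEquality

  <ᵇ-true : ∀ {m n} → m < n → (m <ᵇ n) ≡ true
  <ᵇ-true {m} {n} m<n with m <ᵇ n in e
  ... | true  = refl
  ... | false = ⊥-elim (subst T e (<⇒<ᵇ m<n))

  <ᵇ-false : ∀ {m n} → n ≤ m → (m <ᵇ n) ≡ false
  <ᵇ-false {m} {n} n≤m with m <ᵇ n in e
  ... | false = refl
  ... | true  = ⊥-elim (≤⇒≯ n≤m (<ᵇ⇒< m n (subst T (sym e) _)))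

  not-<ᵇ⇒≥ : ∀ m n → T (not (m <ᵇ n)) → n ≤ m
  not-<ᵇ⇒≥ m n t with m <ᵇ n in e
  ... | true  = ⊥-elim t
  ... | false = ≮⇒≥ (λ m<n → subst T e (<⇒<ᵇ m<n))

  ≡ᵇ-refl : ∀ n → (n ≡ᵇ n) ≡ true
  ≡ᵇ-refl zero    = refl
  ≡ᵇ-refl (suc n) = ≡ᵇ-refl n

  ≡ᵇ-false : ∀ {m n} → m ≢ n → (m ≡ᵇ n) ≡ false
  ≡ᵇ-false {m} {n} m≢n with m ≡ᵇ n in e
  ... | false = refl
  ... | true  = ⊥-elim (m≢n (≡ᵇ⇒≡ m n (subst T (sym e) _)))

  T-∧ˡ : ∀ {b c} → T (b ∧ c) → T b
  T-∧ˡ {true} _ = _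

open import Data.Nat using (ℕ; zero; suc)

-- ifPositive z m v is v when m > 0 and z otherwise; it guards terms that only
-- make sense when a block of some size can actually be removed.
ifPositive : {A : Set} → A → ℕ → A → A
ifPositive z zero    v = z
ifPositive z (suc _) v = v

-- A vector a : Vec ℕ L is read as a multiset of block sizes: its
-- coordinate i counts the blocks of size o + 1 + i, for an offset o (o = 0 for the
-- theorem; general o makes the tail of a vector a block type again).
module BlockTypes where

  open import Data.Nat
  open import Data.Nat.Properties
  open import Data.Nat.Divisibility
  open import Data.Nat.Tactic.RingSolver using (solve-∀)
  open import Algebra.Properties.CommutativeSemigroup *-commutativeSemigroup
    using (x∙yz≈y∙xz; xy∙z≈y∙xz; interchange)
  open import Data.Fin using (Fin; zero; suc; toℕ)
  open import Data.Vec using (Vec; []; _∷_; lookup; sum; map)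
  open import Algebra.Properties.Semiring.Sum +-*-semiring
    using (sum-syntax; sum-cong-≗; *-distribˡ-sum; *-distribʳ-sum)
    renaming (sum to ∑)
  open import Relation.Binary.PropositionalEquality
  open ≡-Reasoning
  open import Defs using (product; numBlocks)
  open Binomial

  sized : {A : Set} {L : ℕ} → (ℕ → ℕ → A) → ℕ → Vec ℕ L → Vec A L
  sized h o []      = []
  sized h o (x ∷ a) = h (suc o) x ∷ sized h (suc o) a

  blockSize : {L : ℕ} → ℕ → Fin L → ℕ
  blockSize o zero    = suc o
  blockSize o (suc i) = blockSize (suc o) i

  blockSize-toℕ : ∀ {L} o (i : Fin L) → blockSize o i ≡ suc (o + toℕ i)
  blockSize-toℕ o zero    = cong suc (sym (+-identityʳ o))
  blockSize-toℕ o (suc i) = trans (blockSize-toℕ (suc o) i) (cong suc (sym (+-suc o (toℕ i))))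

  weightFrom : {L : ℕ} → ℕ → Vec ℕ L → ℕ
  weightFrom o a = sum (sized (λ s x → s * x) o a)

  factorialPowers : {L : ℕ} → ℕ → Vec ℕ L → ℕ
  factorialPowers o a = product (sized (λ s x → (s !) ^ x) o a)

  denominatorFrom : {L : ℕ} → ℕ → Vec ℕ L → ℕ
  denominatorFrom o a = product (sized (λ s x → (s !) ^ x * x !) o a)

  factorials : {L : ℕ} → Vec ℕ L → ℕ
  factorials a = product (map _! a)

  -- The multinomial coefficient (Σ a_s)! / Π a_s!: the number of orderings of the
  -- blocks of a type, i.e. of compositions with that multiset of parts.
  multinomial : {L : ℕ} → Vec ℕ L → ℕ
  multinomial []      = 1
  multinomial (x ∷ a) = binom x (numBlocks a) * multinomial a

  remove : {L : ℕ} → Fin L → Vec ℕ L → Vec ℕ L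
  remove zero    (x ∷ a) = pred x ∷ a
  remove (suc i) (x ∷ a) = x ∷ remove i a

  multinomial-factorials : ∀ {L} (a : Vec ℕ L) → multinomial a * factorials a ≡ numBlocks a !
  multinomial-factorials []      = refl
  multinomial-factorials (x ∷ a) = begin
    binom x (numBlocks a) * multinomial a * (x ! * factorials a)
      ≡⟨ regroup (binom x (numBlocks a)) (multinomial a) (x !) (factorials a) ⟩
    binom x (numBlocks a) * (x ! * (multinomial a * factorials a))
      ≡⟨ cong (λ m → binom x (numBlocks a) * (x ! * m)) (multinomial-factorials a) ⟩
    binom x (numBlocks a) * (x ! * numBlocks a !)
      ≡⟨ binom-factorials x (numBlocks a) ⟩
    (x + numBlocks a) ! ∎
    where
    regroup : ∀ b m X F → b * m * (X * F) ≡ b * (X * (m * F))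
    regroup = solve-∀

  denominator-split : ∀ {L} o (a : Vec ℕ L) → denominatorFrom o a ≡ factorialPowers o a * factorials a
  denominator-split o []      = refl
  denominator-split o (x ∷ a) =
    trans (cong ((suc o !) ^ x * x ! *_) (denominator-split (suc o) a))
          (interchange ((suc o !) ^ x) (x !) (factorialPowers (suc o) a) (factorials a))

  -- The denominator of N' divides (Σ s a_s)!, so N' is an honest quotient.
  denominator-divides : ∀ {L} o (a : Vec ℕ L) → denominatorFrom o a ∣ weightFrom o a !
  denominator-divides o []      = divides 1 refl
  denominator-divides o (x ∷ a) =
    ∣-trans (*-pres-∣ (factorial-power-divides o x) (denominator-divides (suc o) a))
            (divides (binom (suc o * x) (weightFrom (suc o) a))
                     (sym (binom-factorials (suc o * x) (weightFrom (suc o) a))))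

  numBlocks-remove : ∀ {L} (i : Fin L) (a : Vec ℕ L) {u} → lookup a i ≡ suc u →
    suc (numBlocks (remove i a)) ≡ numBlocks a
  numBlocks-remove zero    (x ∷ a) refl = refl
  numBlocks-remove (suc i) (x ∷ a) eq   =
    trans (sym (+-suc x _)) (cong (x +_) (numBlocks-remove i a eq))

  weight-remove : ∀ {L} o (i : Fin L) (a : Vec ℕ L) {u} → lookup a i ≡ suc u →
    weightFrom o (remove i a) + blockSize o i ≡ weightFrom o a
  weight-remove o zero (x ∷ a) {u} refl = shift (suc o) u (weightFrom (suc o) a)
    where
    shift : ∀ s u w → s * u + w + s ≡ s * suc u + w
    shift = solve-∀
  weight-remove o (suc i) (x ∷ a) eq =
    trans (+-assoc (suc o * x) _ _) (cong (suc o * x +_) (weight-remove (suc o) i a eq))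

  multinomial-remove : ∀ {L} (i : Fin L) (a : Vec ℕ L) {u} → lookup a i ≡ suc u →
    numBlocks a * multinomial (remove i a) ≡ lookup a i * multinomial a
  multinomial-remove zero (x ∷ a) {u} refl = begin
    (suc u + numBlocks a) * (binom u (numBlocks a) * multinomial a)
      ≡⟨ sym (*-assoc (suc u + numBlocks a) (binom u (numBlocks a)) (multinomial a)) ⟩
    (suc u + numBlocks a) * binom u (numBlocks a) * multinomial a
      ≡⟨ cong (_* multinomial a) (binom-raiseˡ u (numBlocks a)) ⟩
    suc u * binom (suc u) (numBlocks a) * multinomial a
      ≡⟨ *-assoc (suc u) (binom (suc u) (numBlocks a)) (multinomial a) ⟩
    suc u * (binom (suc u) (numBlocks a) * multinomial a) ∎
  multinomial-remove (suc i) (x ∷ a) eq = begin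
    (x + numBlocks a) * (binom x m * multinomial (remove i a))
      ≡⟨ cong (λ n → (x + n) * (binom x m * multinomial (remove i a))) (sym blocks) ⟩
    (x + suc m) * (binom x m * multinomial (remove i a))
      ≡⟨ sym (*-assoc (x + suc m) (binom x m) _) ⟩
    (x + suc m) * binom x m * multinomial (remove i a)
      ≡⟨ cong (_* multinomial (remove i a)) (binom-raiseʳ x m) ⟩
    suc m * binom x (suc m) * multinomial (remove i a)
      ≡⟨ xy∙z≈y∙xz (suc m) (binom x (suc m)) (multinomial (remove i a)) ⟩
    binom x (suc m) * (suc m * multinomial (remove i a))
      ≡⟨ cong (λ n → binom x n * (n * multinomial (remove i a))) blocks ⟩
    binom x (numBlocks a) * (numBlocks a * multinomial (remove i a))
      ≡⟨ cong (binom x (numBlocks a) *_) (multinomial-remove i a eq) ⟩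
    binom x (numBlocks a) * (lookup a i * multinomial a)
      ≡⟨ x∙yz≈y∙xz (binom x (numBlocks a)) (lookup a i) (multinomial a) ⟩
    lookup a i * (binom x (numBlocks a) * multinomial a) ∎
    where
    m = numBlocks (remove i a)
    blocks : suc m ≡ numBlocks a
    blocks = numBlocks-remove i a eq

  weighted-pascal : ∀ {L} (a : Vec ℕ L) (c : Fin L → ℕ) →
    numBlocks a * ∑[ i < L ] (ifPositive 0 (lookup a i) (c i * multinomial (remove i a)))
      ≡ (∑[ i < L ] (c i * lookup a i)) * multinomial a
  weighted-pascal {L} a c = begin
    numBlocks a * ∑[ i < L ] (ifPositive 0 (lookup a i) (c i * multinomial (remove i a)))
      ≡⟨ *-distribˡ-sum (numBlocks a) (λ i → ifPositive 0 (lookup a i) (c i * multinomial (remove i a))) ⟩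
    ∑[ i < L ] (numBlocks a * ifPositive 0 (lookup a i) (c i * multinomial (remove i a)))
      ≡⟨ sum-cong-≗ term ⟩
    ∑[ i < L ] (c i * lookup a i * multinomial a)
      ≡⟨ sym (*-distribʳ-sum (multinomial a) (λ i → c i * lookup a i)) ⟩
    (∑[ i < L ] (c i * lookup a i)) * multinomial a ∎
    where
    term : ∀ i → numBlocks a * ifPositive 0 (lookup a i) (c i * multinomial (remove i a))
               ≡ c i * lookup a i * multinomial a
    term i with lookup a i in eq
    ... | zero  = trans (*-zeroʳ (numBlocks a)) (cong (_* multinomial a) (sym (*-zeroʳ (c i))))
    ... | suc u = begin
      numBlocks a * (c i * multinomial (remove i a)) ≡⟨ x∙yz≈y∙xz (numBlocks a) (c i) _ ⟩
      c i * (numBlocks a * multinomial (remove i a)) ≡⟨ cong (c i *_) (multinomial-remove i a eq) ⟩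
      c i * (lookup a i * multinomial a)               ≡⟨ cong (λ n → c i * (n * multinomial a)) eq ⟩
      c i * (suc u * multinomial a)                    ≡⟨ sym (*-assoc (c i) (suc u) _) ⟩
      c i * suc u * multinomial a ∎

  sum-lookup : ∀ {L} (a : Vec ℕ L) → ∑[ i < L ] (1 * lookup a i) ≡ numBlocks a
  sum-lookup []      = refl
  sum-lookup (x ∷ a) = cong₂ _+_ (*-identityˡ x) (sum-lookup a)

  weight-as-sum : ∀ {L} o (a : Vec ℕ L) → ∑[ i < L ] (blockSize o i * lookup a i) ≡ weightFrom o a
  weight-as-sum o []      = refl
  weight-as-sum o (x ∷ a) = cong (suc o * x +_) (weight-as-sum (suc o) a)

  -- Pascal's rule: a type with at least one block is ordered by choosing the last block.
  pascal : ∀ {L} (a : Vec ℕ L) → .{{NonZero (numBlocks a)}} →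
    multinomial a ≡ ∑[ i < L ] (ifPositive 0 (lookup a i) (multinomial (remove i a)))
  pascal {L} a = *-cancelˡ-≡ _ _ (numBlocks a) (begin
    numBlocks a * multinomial a
      ≡⟨ cong (_* multinomial a) (sym (sum-lookup a)) ⟩
    (∑[ i < L ] (1 * lookup a i)) * multinomial a
      ≡⟨ sym (weighted-pascal a (λ _ → 1)) ⟩
    numBlocks a * ∑[ i < L ] (ifPositive 0 (lookup a i) (1 * multinomial (remove i a)))
      ≡⟨ cong (numBlocks a *_) (sum-cong-≗ (λ i → cong (ifPositive 0 (lookup a i)) (*-identityˡ _))) ⟩
    numBlocks a * ∑[ i < L ] (ifPositive 0 (lookup a i) (multinomial (remove i a))) ∎)

module TupleSums where

  open import Data.Nat as ℕ using (_≤_; _<ᵇ_; z≤n)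
  import Data.Nat.Properties as ℕₚ
  open import Data.Integer using (ℤ; 0ℤ; _+_; _*_)
  open import Data.Sum using (inj₁; inj₂)
  open import Data.Integer.Properties using (+-*-semiring; +-comm; +-identityʳ; *-zeroˡ; *-zeroʳ)
  open import Data.Bool using (Bool; true; false; if_then_else_; _∧_; not)
  open import Data.Fin using (Fin; zero; suc; toℕ)
  open import Data.Fin.Properties using (toℕ-inject₁; toℕ-fromℕ; toℕ<n)
  open import Data.Vec using (Vec; []; _∷_; lookup)
  open import Algebra.Properties.Semiring.Sum +-*-semiring
    using (sum-syntax; sum-cong-≗; ∑-comm; *-distribˡ-sum; sum-init-last; sum-replicate-zero)
    renaming (sum to ∑)
  open import Relation.Binary.PropositionalEquality
  open ≡-Reasoning
  open BlockTypes using (remove)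
  open Comparisons using (<ᵇ-true; <ᵇ-false)

  ∑< : ℕ → (ℕ → ℤ) → ℤ
  ∑< n f = ∑[ i < n ] f (toℕ i)

  ∑<-cong : ∀ n {f g : ℕ → ℤ} → (∀ p → f p ≡ g p) → ∑< n f ≡ ∑< n g
  ∑<-cong n f≗g = sum-cong-≗ {n} (λ i → f≗g (toℕ i))

  ∑<-zero : ∀ n → ∑< n (λ _ → 0ℤ) ≡ 0ℤ
  ∑<-zero n = sum-replicate-zero n

  ∑<-cong< : ∀ n {f g : ℕ → ℤ} → (∀ p → p ℕ.< n → f p ≡ g p) → ∑< n f ≡ ∑< n g
  ∑<-cong< n f≗g = sum-cong-≗ {n} (λ i → f≗g (toℕ i) (toℕ<n i))

  ∑<-last : ∀ n (f : ℕ → ℤ) → ∑< (suc n) f ≡ ∑< n f + f n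
  ∑<-last n f = trans (sum-init-last {n} (λ i → f (toℕ i)))
    (cong₂ _+_ (sum-cong-≗ {n} (λ i → cong f (toℕ-inject₁ i))) (cong f (toℕ-fromℕ n)))

  onlyIf : Bool → ℤ → ℤ
  onlyIf b v = if b then v else 0ℤ

  ∑<-truncate : ∀ {n L} → n ℕ.≤ L → (g : ℕ → ℤ) →
    ∑< L (λ p → onlyIf (not (n <ᵇ suc p)) (g p)) ≡ ∑< n g
  ∑<-truncate {n} {zero} z≤n g = refl
  ∑<-truncate {n} {suc L} n≤L g with ℕₚ.m≤n⇒m<n∨m≡n n≤L
  ... | inj₁ n<1+L = begin
    ∑< (suc L) f         ≡⟨ ∑<-last L f ⟩
    ∑< L f + f L         ≡⟨ cong (λ b → ∑< L f + onlyIf (not b) (g L)) (<ᵇ-true n<1+L) ⟩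
    ∑< L f + 0ℤ          ≡⟨ +-identityʳ _ ⟩
    ∑< L f               ≡⟨ ∑<-truncate {n} {L} (ℕₚ.<⇒≤pred n<1+L) g ⟩
    ∑< n g               ∎
    where
    f : ℕ → ℤ
    f p = onlyIf (not (n <ᵇ suc p)) (g p)
  ... | inj₂ refl = ∑<-cong< (suc L) (λ p p<n → cong (λ b → onlyIf (not b) (g p)) (<ᵇ-false p<n))

  ∑box : (L B : ℕ) → (Vec ℕ L → ℤ) → ℤ
  ∑box zero    B F = F []
  ∑box (suc L) B F = ∑< (suc B) (λ x → ∑box L B (λ a → F (x ∷ a)))

  ∑box-cong : ∀ L B {F G : Vec ℕ L → ℤ} → (∀ a → F a ≡ G a) → ∑box L B F ≡ ∑box L B G
  ∑box-cong zero    B F≗G = F≗G []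
  ∑box-cong (suc L) B F≗G = ∑<-cong (suc B) (λ x → ∑box-cong L B (λ a → F≗G (x ∷ a)))

  ∑box-zero : ∀ L B → ∑box L B (λ _ → 0ℤ) ≡ 0ℤ
  ∑box-zero zero    B = refl
  ∑box-zero (suc L) B = trans (∑<-cong (suc B) (λ _ → ∑box-zero L B)) (∑<-zero (suc B))

  ∑box-*ˡ : ∀ L B c (F : Vec ℕ L → ℤ) → ∑box L B (λ a → c * F a) ≡ c * ∑box L B F
  ∑box-*ˡ zero    B c F = refl
  ∑box-*ˡ (suc L) B c F =
    trans (∑<-cong (suc B) (λ x → ∑box-*ˡ L B c (λ a → F (x ∷ a))))
          (sym (*-distribˡ-sum {suc B} c (λ i → ∑box L B (λ a → F (toℕ i ∷ a)))))

  ∑box-∑ : ∀ L B {M} (H : Fin M → Vec ℕ L → ℤ) →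
    ∑box L B (λ a → ∑[ i < M ] H i a) ≡ ∑[ i < M ] ∑box L B (H i)
  ∑box-∑ zero    B H = refl
  ∑box-∑ (suc L) B H =
    trans (∑<-cong (suc B) (λ x → ∑box-∑ L B (λ i a → H i (x ∷ a))))
          (∑-comm {suc B} (λ x i → ∑box L B (λ a → H i (toℕ x ∷ a))))

  -- Adding a block of the size counted by coordinate i is a bijection from the box onto
  -- the tuples with a_i > 0, provided nothing is lost at the upper face a_i = B.
  ∑box-remove : ∀ L B (i : Fin L) (K : Vec ℕ L → ℤ) → (∀ b → B ≤ lookup b i → K b ≡ 0ℤ) →
    ∑box L B (λ a → ifPositive 0ℤ (lookup a i) (K (remove i a))) ≡ ∑box L B K
  ∑box-remove (suc L) B zero K vanish = begin
    ∑box L B (λ _ → 0ℤ) + S             ≡⟨ cong (_+ S) (∑box-zero L B) ⟩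
    0ℤ + S                              ≡⟨ +-comm 0ℤ S ⟩
    S + 0ℤ                              ≡⟨ cong (S +_) (sym upperFace) ⟩
    S + ∑box L B (λ a → K (B ∷ a))      ≡⟨ sym (∑<-last B (λ x → ∑box L B (λ a → K (x ∷ a)))) ⟩
    ∑< (suc B) (λ x → ∑box L B (λ a → K (x ∷ a))) ∎
    where
    S = ∑< B (λ x → ∑box L B (λ a → K (x ∷ a)))
    upperFace : ∑box L B (λ a → K (B ∷ a)) ≡ 0ℤ
    upperFace = trans (∑box-cong L B (λ a → vanish (B ∷ a) ℕₚ.≤-refl)) (∑box-zero L B)
  ∑box-remove (suc L) B (suc i) K vanish =
    ∑<-cong (suc B) (λ x → ∑box-remove L B i (λ a → K (x ∷ a)) (λ a → vanish (x ∷ a)))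

  onlyIf-zero : ∀ b → onlyIf b 0ℤ ≡ 0ℤ
  onlyIf-zero true  = refl
  onlyIf-zero false = refl

  onlyIf-∧ : ∀ b c v → onlyIf (b ∧ c) v ≡ onlyIf b (onlyIf c v)
  onlyIf-∧ true  c v = refl
  onlyIf-∧ false c v = refl

  onlyIf-*ˡ : ∀ b x v → onlyIf b (x * v) ≡ x * onlyIf b v
  onlyIf-*ˡ true  x v = refl
  onlyIf-*ˡ false x v = sym (*-zeroʳ x)

  onlyIf-*ʳ : ∀ b x v → onlyIf b (x * v) ≡ onlyIf b x * v
  onlyIf-*ʳ true  x v = refl
  onlyIf-*ʳ false x v = sym (*-zeroˡ v)

  onlyIf-∑ : ∀ b {M} (f : Fin M → ℤ) → onlyIf b (∑[ i < M ] f i) ≡ ∑[ i < M ] onlyIf b (f i)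
  onlyIf-∑ true  f = refl
  onlyIf-∑ false {M} f = sym (sum-replicate-zero M)

  ∑box-onlyIf : ∀ L B b (F : Vec ℕ L → ℤ) → ∑box L B (λ a → onlyIf b (F a)) ≡ onlyIf b (∑box L B F)
  ∑box-onlyIf L B true  F = refl
  ∑box-onlyIf L B false F = ∑box-zero L B

module Admissible where

  open import Data.Nat as ℕ using (_+_; _∸_; _≤_; _<_; _<ᵇ_; _≡ᵇ_; s≤s)
  import Data.Nat.Properties as ℕₚ
  open import Data.Integer using (ℤ; 0ℤ)
  open import Data.Integer.Properties using (+-*-semiring)
  open import Data.Bool using (Bool; true; false; if_then_else_; _∧_; not; T)
  open import Data.Bool.Properties using (∧-commutativeMonoid)
  open import Algebra.Bundles using (CommutativeMonoid)
  open import Algebra.Properties.CommutativeSemigroup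
    (CommutativeMonoid.commutativeSemigroup ∧-commutativeMonoid) using (interchange; x∙yz≈y∙xz)
  open import Data.Fin using (Fin; zero; suc)
  open import Data.Vec using (Vec; _∷_; lookup; toList)
  open import Data.List using (foldr)
  open import Data.Empty using (⊥-elim)
  open import Algebra.Properties.Semiring.Sum +-*-semiring
    using (sum-syntax; sum-cong-≗) renaming (sum to ∑)
  open import Relation.Binary.PropositionalEquality
  open ≡-Reasoning
  open BlockTypes
  open TupleSums
  open Comparisons using (not-<ᵇ⇒≥; T-∧ˡ)

  partsAtMost : {L : ℕ} → ℕ → ℕ → Vec ℕ L → Bool
  partsAtMost j o a = foldr _∧_ true (toList (sized (λ s x → if j <ᵇ s then x ≡ᵇ 0 else true) o a))

  admissible : {L : ℕ} → ℕ → ℕ → Vec ℕ L → Bool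
  admissible j n a = (weightFrom 0 a ≡ᵇ n) ∧ partsAtMost j 0 a

  fits : ℕ → ℕ → ℕ → Bool
  fits j n s = not (n <ᵇ s) ∧ not (j <ᵇ s)

  partsAtMost-remove : ∀ {L} j o (i : Fin L) (a : Vec ℕ L) {u} → lookup a i ≡ suc u →
    partsAtMost j o a ≡ not (j <ᵇ blockSize o i) ∧ partsAtMost j o (remove i a)
  partsAtMost-remove j o zero (x ∷ a) refl with j <ᵇ suc o
  ... | true  = refl
  ... | false = refl
  partsAtMost-remove j o (suc i) (x ∷ a) eq =
    trans (cong ((if j <ᵇ suc o then x ≡ᵇ 0 else true) ∧_) (partsAtMost-remove j (suc o) i a eq))
          (x∙yz≈y∙xz (if j <ᵇ suc o then x ≡ᵇ 0 else true) (not (j <ᵇ blockSize (suc o) i)) _)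

  weight-test : ∀ w s n → (w + s ≡ᵇ n) ≡ not (n <ᵇ s) ∧ (w ≡ᵇ n ∸ s)
  weight-test w zero    n       rewrite ℕₚ.+-identityʳ w = refl
  weight-test w (suc s) zero    rewrite ℕₚ.+-suc w s = refl
  weight-test w (suc s) (suc n) rewrite ℕₚ.+-suc w s = weight-test w s n

  admissible-remove : ∀ {L} j n (i : Fin L) (a : Vec ℕ L) {u} → lookup a i ≡ suc u →
    admissible j n a ≡ fits j n (blockSize 0 i) ∧ admissible j (n ∸ blockSize 0 i) (remove i a)
  admissible-remove j n i a eq = begin
    (weightFrom 0 a ≡ᵇ n) ∧ partsAtMost j 0 a
      ≡⟨ cong₂ (λ w z → (w ≡ᵇ n) ∧ z) (sym (weight-remove 0 i a eq)) (partsAtMost-remove j 0 i a eq) ⟩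
    (weightFrom 0 a′ + s ≡ᵇ n) ∧ (not (j <ᵇ s) ∧ partsAtMost j 0 a′)
      ≡⟨ cong (_∧ (not (j <ᵇ s) ∧ partsAtMost j 0 a′)) (weight-test (weightFrom 0 a′) s n) ⟩
    (not (n <ᵇ s) ∧ (weightFrom 0 a′ ≡ᵇ n ∸ s)) ∧ (not (j <ᵇ s) ∧ partsAtMost j 0 a′)
      ≡⟨ interchange (not (n <ᵇ s)) (weightFrom 0 a′ ≡ᵇ n ∸ s) (not (j <ᵇ s)) (partsAtMost j 0 a′) ⟩
    fits j n s ∧ admissible j (n ∸ s) a′ ∎
    where
    s  = blockSize 0 i
    a′ = remove i a

  lookup≤weight : ∀ {L} o (i : Fin L) (b : Vec ℕ L) → lookup b i ≤ weightFrom o b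
  lookup≤weight o zero    (x ∷ b) = ℕₚ.≤-trans (ℕₚ.m≤n*m x (suc o)) (ℕₚ.m≤m+n _ _)
  lookup≤weight o (suc i) (x ∷ b) = ℕₚ.≤-trans (lookup≤weight (suc o) i b) (ℕₚ.m≤n+m _ _)

  onlyIf-admissible : ∀ {L} j n (a : Vec ℕ L) {x y : ℤ} → (weightFrom 0 a ≡ n → x ≡ y) →
    onlyIf (admissible j n a) x ≡ onlyIf (admissible j n a) y
  onlyIf-admissible j n a x≡y with admissible j n a in adm
  ... | false = refl
  ... | true  = x≡y (ℕₚ.≡ᵇ⇒≡ _ _ (T-∧ˡ (subst T (sym adm) _)))

  -- Within a box of side B ≥ n, an admissible type of weight n - s (for a fitting
  -- block size s ≥ 1) stays off the upper face: its coordinates are ≤ n - s < n ≤ B.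
  below-upper-face : ∀ {L} j n B → n ≤ B → (i : Fin L) (b : Vec ℕ L) →
    T (fits j n (blockSize 0 i)) → T (admissible j (n ∸ blockSize 0 i) b) → lookup b i < B
  below-upper-face j n B n≤B i b fit adm =
    ℕₚ.≤-<-trans (lookup≤weight 0 i b) (ℕₚ.<-≤-trans (subst (_< n) (sym weight-b) n∸s<n) n≤B)
    where
    weight-b : weightFrom 0 b ≡ n ∸ blockSize 0 i
    weight-b = ℕₚ.≡ᵇ⇒≡ _ _ (T-∧ˡ adm)
    n∸s<n : n ∸ blockSize 0 i < n
    n∸s<n = ℕₚ.∸-monoʳ-< (subst (0 <_) (sym (blockSize-toℕ 0 i)) (s≤s ℕ.z≤n))
                        (not-<ᵇ⇒≥ n (blockSize 0 i) (T-∧ˡ fit))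

  ∑-by-removed-block : ∀ j n L B → n ≤ B → (G : Fin L → Vec ℕ L → ℤ) →
    ∑box L B (λ a → onlyIf (admissible j n a)
                      (∑[ i < L ] ifPositive 0ℤ (lookup a i) (G i (remove i a))))
      ≡ ∑[ i < L ] onlyIf (fits j n (blockSize 0 i))
                      (∑box L B (λ b → onlyIf (admissible j (n ∸ blockSize 0 i) b) (G i b)))
  ∑-by-removed-block j n L B n≤B G = begin
    ∑box L B (λ a → onlyIf (admissible j n a) (∑[ i < L ] ifPositive 0ℤ (lookup a i) (G i (remove i a))))
      ≡⟨ ∑box-cong L B (λ a → trans (onlyIf-∑ (admissible j n a) {L} _) (sum-cong-≗ {L} (term a))) ⟩
    ∑box L B (λ a → ∑[ i < L ] ifPositive 0ℤ (lookup a i) (K i (remove i a)))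
      ≡⟨ ∑box-∑ L B (λ i a → ifPositive 0ℤ (lookup a i) (K i (remove i a))) ⟩
    ∑[ i < L ] ∑box L B (λ a → ifPositive 0ℤ (lookup a i) (K i (remove i a)))
      ≡⟨ sum-cong-≗ {L} (λ i → ∑box-remove L B i (K i) (off-face i)) ⟩
    ∑[ i < L ] ∑box L B (K i)
      ≡⟨ sum-cong-≗ {L} (λ i → ∑box-onlyIf L B (fits j n (blockSize 0 i)) _) ⟩
    ∑[ i < L ] onlyIf (fits j n (blockSize 0 i))
                 (∑box L B (λ b → onlyIf (admissible j (n ∸ blockSize 0 i) b) (G i b))) ∎
    where
    K : Fin L → Vec ℕ L → ℤ
    K i b = onlyIf (fits j n (blockSize 0 i)) (onlyIf (admissible j (n ∸ blockSize 0 i) b) (G i b))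
    term : ∀ a i → onlyIf (admissible j n a) (ifPositive 0ℤ (lookup a i) (G i (remove i a)))
                 ≡ ifPositive 0ℤ (lookup a i) (K i (remove i a))
    term a i with lookup a i in eq
    ... | zero  = onlyIf-zero (admissible j n a)
    ... | suc u = trans (cong (λ c → onlyIf c (G i (remove i a))) (admissible-remove j n i a eq))
                        (onlyIf-∧ (fits j n (blockSize 0 i)) _ _)
    off-face : ∀ i b → B ≤ lookup b i → K i b ≡ 0ℤ
    off-face i b B≤bᵢ with fits j n (blockSize 0 i) in fit | admissible j (n ∸ blockSize 0 i) b in adm
    ... | false | _     = refl
    ... | true  | false = refl
    ... | true  | true  = ⊥-elim (ℕₚ.<-irrefl refl (ℕₚ.<-≤-trans
          (below-upper-face j n B n≤B i b (subst T (sym fit) _) (subst T (sym adm) _)) B≤bᵢ))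

module DefsBridge where

  open import Data.Nat as ℕ using (_*_; _^_; _!; _<ᵇ_; _≡ᵇ_)
  import Data.Nat.Properties as ℕₚ
  open import Data.Integer using (ℤ; 0ℤ; _+_)
  open import Data.Integer.Properties using (+-identityˡ; +-identityʳ; +-assoc)
  open import Data.Bool using (Bool; true; if_then_else_; _∧_)
  open import Data.Fin as Fin using (Fin; toℕ)
  open import Data.Vec as V using (Vec; []; _∷_; lookup; tabulate; toList)
  import Data.Vec.Properties as V
  open import Data.List as L using (List; map; concatMap; applyUpTo; _++_; foldr)
  import Data.List.Properties as L
  open import Relation.Binary.PropositionalEquality
  open ≡-Reasoning
  open import Defs
  open BlockTypes
  open TupleSums
  open Admissible

  tabulate-sized : ∀ {L} {A : Set} (h : ℕ → ℕ → A) o (a : Vec ℕ L) →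
    tabulate (λ i → h (o ℕ.+ suc (toℕ i)) (lookup a i)) ≡ sized h o a
  tabulate-sized h o []      = refl
  tabulate-sized h o (x ∷ a) = cong₂ _∷_ (cong (λ s → h s x) (ℕₚ.+-comm o 1))
    (trans (V.tabulate-cong (λ i → cong (λ s → h s (lookup a i)) (ℕₚ.+-suc o (suc (toℕ i)))))
           (tabulate-sized h (suc o) a))

  list-tabulate : ∀ {L} {A : Set} (f : Fin L → A) → L.tabulate f ≡ toList (tabulate f)
  list-tabulate {zero}  f = refl
  list-tabulate {suc L} f = cong (f Fin.zero L.∷_) (list-tabulate (λ i → f (Fin.suc i)))

  weight-bridge : ∀ {L} (a : Vec ℕ L) → weight a ≡ weightFrom 0 a
  weight-bridge a = cong V.sum (tabulate-sized (λ s x → s * x) 0 a)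

  factPow-bridge : ∀ {L} (a : Vec ℕ L) → factPow a ≡ factorialPowers 0 a
  factPow-bridge a = cong product (tabulate-sized (λ s x → (s !) ^ x) 0 a)

  denom-bridge : ∀ {L} (a : Vec ℕ L) → denom a ≡ denominatorFrom 0 a
  denom-bridge a = cong product (tabulate-sized (λ s x → (s !) ^ x * x !) 0 a)

  inRange-bridge : ∀ k j (a : Vec ℕ k) → inRange k j a ≡ admissible j k a
  inRange-bridge k j a = cong₂ (λ w z → (w ≡ᵇ k) ∧ z) (weight-bridge a) (begin
    foldr _∧_ true (map test (L.allFin k))  ≡⟨ cong (foldr _∧_ true) (L.map-tabulate (λ i → i) test) ⟩
    foldr _∧_ true (L.tabulate test)         ≡⟨ cong (foldr _∧_ true) (list-tabulate test) ⟩
    foldr _∧_ true (toList (tabulate test))  ≡⟨ cong (λ v → foldr _∧_ true (toList v)) (tabulate-sized bigZero 0 a) ⟩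
    partsAtMost j 0 a ∎)
    where
    bigZero : ℕ → ℕ → Bool
    bigZero s x = if j <ᵇ s then x ≡ᵇ 0 else true
    test : Fin k → Bool
    test i = bigZero (suc (toℕ i)) (lookup a i)

  listSum : List ℤ → ℤ
  listSum = foldr _+_ 0ℤ

  listSum-++ : ∀ xs ys → listSum (xs ++ ys) ≡ listSum xs + listSum ys
  listSum-++ L.[]       ys = sym (+-identityˡ _)
  listSum-++ (x L.∷ xs) ys = trans (cong (x +_) (listSum-++ xs ys)) (sym (+-assoc x _ _))

  listSum-concatMap : ∀ {A B : Set} (f : B → ℤ) (g : A → List B) xs →
    listSum (map f (concatMap g xs)) ≡ listSum (map (λ x → listSum (map f (g x))) xs)
  listSum-concatMap f g L.[]       = refl
  listSum-concatMap f g (x L.∷ xs) = begin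
    listSum (map f (g x ++ concatMap g xs))
      ≡⟨ cong listSum (L.map-++ f (g x) (concatMap g xs)) ⟩
    listSum (map f (g x) ++ map f (concatMap g xs))
      ≡⟨ listSum-++ (map f (g x)) _ ⟩
    listSum (map f (g x)) + listSum (map f (concatMap g xs))
      ≡⟨ cong (listSum (map f (g x)) +_) (listSum-concatMap f g xs) ⟩
    listSum (map f (g x)) + listSum (map (λ x → listSum (map f (g x))) xs) ∎

  listSum-applyUpTo : ∀ (F : ℕ → ℤ) h n → listSum (map F (applyUpTo h n)) ≡ ∑< n (λ p → F (h p))
  listSum-applyUpTo F h zero    = refl
  listSum-applyUpTo F h (suc n) = cong (F (h 0) +_) (listSum-applyUpTo F (λ p → h (suc p)) n)

  listSum-tuples : ∀ L B (F : Vec ℕ L → ℤ) → listSum (map F (tuples L B)) ≡ ∑box L B F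
  listSum-tuples zero    B F = +-identityʳ (F [])
  listSum-tuples (suc L) B F = begin
    listSum (map F (concatMap (λ x → map (x ∷_) (tuples L B)) (L.upTo (suc B))))
      ≡⟨ listSum-concatMap F (λ x → map (x ∷_) (tuples L B)) (L.upTo (suc B)) ⟩
    listSum (map (λ x → listSum (map F (map (x ∷_) (tuples L B)))) (L.upTo (suc B)))
      ≡⟨ listSum-applyUpTo (λ x → listSum (map F (map (x ∷_) (tuples L B)))) (λ x → x) (suc B) ⟩
    ∑< (suc B) (λ x → listSum (map F (map (x ∷_) (tuples L B))))
      ≡⟨ ∑<-cong (suc B) (λ x → trans (cong listSum (sym (L.map-∘ {g = F} {f = x ∷_} (tuples L B))))
                                        (listSum-tuples L B (λ a → F (x ∷ a)))) ⟩
    ∑box (suc L) B F ∎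

  LHS-as-∑box : ∀ k j → LHS k j ≡ ∑box k k (λ a → onlyIf (admissible j k a) (summand a))
  LHS-as-∑box k j = trans (listSum-tuples k k _)
    (∑box-cong k k (λ a → cong (λ b → onlyIf b (summand a)) (inRange-bridge k j a)))

module SummandArithmetic where

  open import Data.Nat
  open import Data.Nat.Properties
  open import Data.Nat.Divisibility using (_∣_)
  open import Data.Nat.DivMod using (m/n*n≡m)
  open import Data.Nat.Tactic.RingSolver using (solve-∀)
  open import Data.Vec using (Vec; []; _∷_; lookup)
  open import Algebra.Properties.Semiring.Sum +-*-semiring using (sum-syntax)
  open import Relation.Binary.PropositionalEquality
  open ≡-Reasoning
  open import Defs using (N'; factPow; denom; denom-nonZero; numBlocks)
  open BlockTypes
  open DefsBridge using (factPow-bridge; denom-bridge)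

  -- Σ_i [a_i > 0] s_i M(a - e_i): compositions of type a, weighted by their last part.
  lastPartSum : {L : ℕ} → Vec ℕ L → ℕ
  lastPartSum {L} a = ∑[ i < L ] ifPositive 0 (lookup a i) (blockSize 0 i * multinomial (remove i a))

  factorials-nonZero : ∀ {L} (a : Vec ℕ L) → NonZero (factorials a)
  factorials-nonZero []      = _
  factorials-nonZero (x ∷ a) = m*n≢0 (x !) (factorials a) {{x !≢0}} {{factorials-nonZero a}}

  weight-zero : ∀ {L} o (a : Vec ℕ L) → numBlocks a ≡ 0 → weightFrom o a ≡ 0
  weight-zero o []       _    = refl
  weight-zero o (0 ∷ a) none rewrite *-zeroʳ o = weight-zero (suc o) a none

  -- N'(a) is exactly k!/Π s!^{a_s} a_s!, since the denominator divides k!.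
  N'-denom : ∀ {k} (a : Vec ℕ k) → weightFrom 0 a ≡ k → N' a * denom a ≡ k !
  N'-denom a w≡k = m/n*n≡m {{denom-nonZero a}}
    (subst₂ _∣_ (sym (denom-bridge a)) (cong _! w≡k) (denominator-divides 0 a))

  -- The arithmetic core: multiplying both sides by m Π a_s! turns them into k! m!,
  -- by the weighted Pascal rule with weights the block sizes.
  summand-numerator : ∀ {k′} m′ (a : Vec ℕ (suc k′)) →
    weightFrom 0 a ≡ suc k′ → numBlocks a ≡ suc m′ →
    N' a * factPow a * m′ ! ≡ k′ ! * lastPartSum a
  summand-numerator {k′} m′ a w≡k m≡ = *-cancelʳ-≡ _ _ c
    {{m*n≢0 (factorials a) (suc m′) {{factorials-nonZero a}}}} (begin
    N' a * factPow a * m′ ! * c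
      ≡⟨ regroup₁ (N' a) (factPow a) (m′ !) (factorials a) (suc m′) ⟩
    N' a * (factPow a * factorials a) * (suc m′ !)
      ≡⟨ cong (λ d → N' a * d * (suc m′ !)) (sym denom-split) ⟩
    N' a * denom a * (suc m′ !)
      ≡⟨ cong (_* (suc m′ !)) (N'-denom a w≡k) ⟩
    (suc k′ !) * (suc m′ !)
      ≡⟨ cong (λ n → (suc k′ !) * (n !)) (sym m≡) ⟩
    (suc k′ !) * (numBlocks a !)
      ≡⟨ cong ((suc k′ !) *_) (sym (multinomial-factorials a)) ⟩
    (suc k′ * k′ !) * (multinomial a * factorials a)
      ≡⟨ regroup₂ k′ (k′ !) (multinomial a) (factorials a) ⟩
    k′ ! * ((suc k′ * multinomial a) * factorials a)
      ≡⟨ cong (λ n → k′ ! * (n * factorials a)) (sym pascal-by-size) ⟩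
    k′ ! * ((numBlocks a * lastPartSum a) * factorials a)
      ≡⟨ cong (λ n → k′ ! * ((n * lastPartSum a) * factorials a)) m≡ ⟩
    k′ ! * ((suc m′ * lastPartSum a) * factorials a)
      ≡⟨ regroup₃ (k′ !) (suc m′) (lastPartSum a) (factorials a) ⟩
    k′ ! * lastPartSum a * c ∎)
    where
    c = factorials a * suc m′
    denom-split : denom a ≡ factPow a * factorials a
    denom-split = trans (denom-bridge a)
      (trans (denominator-split 0 a) (cong (_* factorials a) (sym (factPow-bridge a))))
    pascal-by-size : numBlocks a * lastPartSum a ≡ suc k′ * multinomial a
    pascal-by-size = trans (weighted-pascal a (blockSize 0))
      (cong (_* multinomial a) (trans (weight-as-sum 0 a) w≡k))
    regroup₁ : ∀ N F M P S → N * F * M * (P * S) ≡ N * (F * P) * (S * M)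
    regroup₁ = solve-∀
    regroup₂ : ∀ k K M P → (suc k * K) * (M * P) ≡ K * ((suc k * M) * P)
    regroup₂ = solve-∀
    regroup₃ : ∀ K S R P → K * ((S * R) * P) ≡ K * R * (P * S)
    regroup₃ = solve-∀

module Summand where

  open import Data.Nat as ℕ using (_!)
  import Data.Nat.Properties as ℕₚ
  open import Data.Integer using (ℤ; +_; 0ℤ; -1ℤ; _+_; _*_; _^_)
  open import Data.Integer.Properties using (+-*-semiring; *-commutativeSemigroup; pos-+; pos-*; *-zeroʳ)
  open import Algebra.Properties.CommutativeSemigroup *-commutativeSemigroup using (x∙yz≈y∙xz; xy∙z≈y∙xz)
  open import Data.Fin using (Fin; zero; suc)
  open import Data.Vec using (Vec; lookup)
  open import Data.Empty using (⊥-elim)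
  import Algebra.Properties.Semiring.Sum ℕₚ.+-*-semiring as ℕΣ
  open import Algebra.Properties.Semiring.Sum +-*-semiring
    using (sum-syntax; sum-cong-≗; *-distribˡ-sum) renaming (sum to ∑)
  open import Relation.Binary.PropositionalEquality
  open ≡-Reasoning
  open import Defs using (N'; factPow; summand; numBlocks)
  open BlockTypes
  open SummandArithmetic

  sign : ℕ → ℤ
  sign n = -1ℤ ^ n

  signedMultinomial : {L : ℕ} → Vec ℕ L → ℤ
  signedMultinomial b = sign (numBlocks b) * + multinomial b

  +-∑ : ∀ {n} (f : Fin n → ℕ) → + ℕΣ.sum {n} f ≡ ∑[ i < n ] (+ f i)
  +-∑ {zero}  f = refl
  +-∑ {suc n} f = trans (pos-+ (f zero) _) (cong (_+_ (+ f zero)) (+-∑ (λ i → f (suc i))))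

  -- Signs pass through block removal: if a has m + 1 blocks, every a - e_i has m, so
  --   (-1)^m Σ_i [a_i > 0] c_i M(a - e_i) = Σ_i [a_i > 0] c_i (-1)^{#blocks} M(a - e_i).
  signed-removal-sum : ∀ {L} (a : Vec ℕ L) m (c : Fin L → ℕ) → numBlocks a ≡ suc m →
    sign m * + ℕΣ.sum {L} (λ i → ifPositive 0 (lookup a i) (c i ℕ.* multinomial (remove i a)))
      ≡ ∑[ i < L ] ifPositive 0ℤ (lookup a i) (+ c i * signedMultinomial (remove i a))
  signed-removal-sum {L} a m c m≡ = begin
    sign m * + ℕΣ.sum {L} term                    ≡⟨ cong (sign m *_) (+-∑ {L} term) ⟩
    sign m * ∑[ i < L ] (+ term i)                ≡⟨ *-distribˡ-sum {L} (sign m) (λ i → + term i) ⟩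
    ∑[ i < L ] (sign m * + term i)                ≡⟨ sum-cong-≗ {L} signed-term ⟩
    ∑[ i < L ] ifPositive 0ℤ (lookup a i) (+ c i * signedMultinomial (remove i a)) ∎
    where
    term : Fin L → ℕ
    term i = ifPositive 0 (lookup a i) (c i ℕ.* multinomial (remove i a))
    signed-term : ∀ i → sign m * + term i ≡ ifPositive 0ℤ (lookup a i) (+ c i * signedMultinomial (remove i a))
    signed-term i with lookup a i in aᵢ
    ... | zero  = *-zeroʳ (sign m)
    ... | suc u = begin
      sign m * + (c i ℕ.* multinomial (remove i a))      ≡⟨ cong (sign m *_) (pos-* (c i) (multinomial (remove i a))) ⟩
      sign m * (+ c i * + multinomial (remove i a))      ≡⟨ x∙yz≈y∙xz (sign m) (+ c i) (+ multinomial (remove i a)) ⟩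
      + c i * (sign m * + multinomial (remove i a))      ≡⟨ cong (λ n → + c i * (sign n * + multinomial (remove i a))) m≡m′ ⟩
      + c i * signedMultinomial (remove i a)             ∎
      where
      m≡m′ : m ≡ numBlocks (remove i a)
      m≡m′ = ℕₚ.suc-injective (trans (sym m≡) (sym (numBlocks-remove i a aᵢ)))

  summand-by-last-part : ∀ {k′} (a : Vec ℕ (suc k′)) → weightFrom 0 a ≡ suc k′ →
    summand a ≡ + (k′ !) * ∑[ i < suc k′ ] ifPositive 0ℤ (lookup a i)
                                             (+ blockSize 0 i * signedMultinomial (remove i a))
  summand-by-last-part {k′} a w≡k with numBlocks a in m≡
  ... | zero   = ⊥-elim (ℕₚ.0≢1+n (trans (sym (weight-zero 0 a m≡)) w≡k))
  ... | suc m′ = begin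
    + (N' a ℕ.* factPow a) * sign m′ * + (m′ !)
      ≡⟨ xy∙z≈y∙xz (+ (N' a ℕ.* factPow a)) (sign m′) (+ (m′ !)) ⟩
    sign m′ * (+ (N' a ℕ.* factPow a) * + (m′ !))
      ≡⟨ cong (sign m′ *_) (sym (pos-* (N' a ℕ.* factPow a) (m′ !))) ⟩
    sign m′ * + (N' a ℕ.* factPow a ℕ.* m′ !)
      ≡⟨ cong (λ n → sign m′ * + n) (summand-numerator m′ a w≡k m≡) ⟩
    sign m′ * + (k′ ! ℕ.* lastPartSum a)
      ≡⟨ cong (sign m′ *_) (pos-* (k′ !) (lastPartSum a)) ⟩
    sign m′ * (+ (k′ !) * + lastPartSum a)
      ≡⟨ x∙yz≈y∙xz (sign m′) (+ (k′ !)) (+ lastPartSum a) ⟩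
    + (k′ !) * (sign m′ * + lastPartSum a)
      ≡⟨ cong (+ (k′ !) *_) (signed-removal-sum a m′ (blockSize 0) m≡) ⟩
    + (k′ !) * ∑[ i < suc k′ ] ifPositive 0ℤ (lookup a i)
                                 (+ blockSize 0 i * signedMultinomial (remove i a)) ∎

-- Truncated convolution of coefficient sequences, indexed so that c p is the
-- coefficient of x^{p+1}:  conv c e n = Σ_{p<n} c_p e_{n-1-p}.
module Convolution where

  open import Data.Nat as ℕ using (_≤_; _<_; _∸_; _<ᵇ_; _≡ᵇ_; s≤s; z≤n)
  import Data.Nat.Properties as ℕₚ
  open import Data.Nat.Induction using (<-rec)
  open import Data.Integer using (ℤ; +_; 0ℤ; _+_; _*_; -_)
  open import Data.Integer.Properties
    using (+-*-semiring; +-identityˡ; +-identityʳ; *-identityˡ; *-assoc; *-distribʳ-+)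
  open import Data.Bool using (not)
  open import Data.Fin using (toℕ)
  open import Algebra.Properties.Semiring.Sum +-*-semiring using (∑-distrib-+; *-distribˡ-sum)
  open import Relation.Binary.PropositionalEquality
  open ≡-Reasoning
  open TupleSums

  conv : (ℕ → ℤ) → (ℕ → ℤ) → ℕ → ℤ
  conv c e n = ∑< n (λ p → c p * e (n ∸ suc p))

  -- The allowed part sizes 1,…,j, as coefficients of x + ⋯ + x^j, and the part
  -- sizes weighted by themselves, as coefficients of x + 2x² + ⋯ + j x^j.
  partsUpTo : ℕ → ℕ → ℤ
  partsUpTo j p = onlyIf (not (j <ᵇ suc p)) (+ 1)

  weightedPartsUpTo : ℕ → ℕ → ℤ
  weightedPartsUpTo j p = onlyIf (not (j <ᵇ suc p)) (+ suc p)

  conv-cong< : ∀ c n {e e′ : ℕ → ℤ} → (∀ m → m < n → e m ≡ e′ m) → conv c e n ≡ conv c e′ n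
  conv-cong< c n e≗e′ = ∑<-cong< n (λ p p<n →
    cong (c p *_) (e≗e′ (n ∸ suc p) (ℕₚ.∸-monoʳ-< (s≤s z≤n) p<n)))

  conv-cong : ∀ {c c′} e n → (∀ p → c p ≡ c′ p) → conv c e n ≡ conv c′ e n
  conv-cong e n c≗c′ = ∑<-cong n (λ p → cong (_* e (n ∸ suc p)) (c≗c′ p))

  conv-+ : ∀ c₁ c₂ e n → conv (λ p → c₁ p + c₂ p) e n ≡ conv c₁ e n + conv c₂ e n
  conv-+ c₁ c₂ e n =
    trans (∑<-cong n (λ p → *-distribʳ-+ (e (n ∸ suc p)) (c₁ p) (c₂ p)))
          (∑-distrib-+ {n} (λ i → c₁ (toℕ i) * e (n ∸ suc (toℕ i))) (λ i → c₂ (toℕ i) * e (n ∸ suc (toℕ i))))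

  conv-*ˡ : ∀ x c e n → conv (λ p → x * c p) e n ≡ x * conv c e n
  conv-*ˡ x c e n =
    trans (∑<-cong n (λ p → *-assoc x (c p) (e (n ∸ suc p))))
          (sym (*-distribˡ-sum {n} x (λ i → c (toℕ i) * e (n ∸ suc (toℕ i)))))

  conv-monomial : ∀ q e n → conv (λ p → onlyIf (p ≡ᵇ q) (+ 1)) e n ≡ onlyIf (q <ᵇ n) (e (n ∸ suc q))
  conv-monomial q       e zero    = refl
  conv-monomial zero    e (suc n) = begin
    + 1 * e n + conv (λ _ → 0ℤ) e n ≡⟨ cong₂ _+_ (*-identityˡ (e n)) (∑<-zero n) ⟩
    e n + 0ℤ                          ≡⟨ +-identityʳ (e n) ⟩
    e n ∎
  conv-monomial (suc q) e (suc n) = trans (+-identityˡ _) (conv-monomial q e n)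

  recurrence-determines : ∀ N c (e e′ : ℕ → ℤ) → e 0 ≡ e′ 0 →
    (∀ n → suc n ≤ N → e (suc n) ≡ - conv c e (suc n)) →
    (∀ n → e′ (suc n) ≡ - conv c e′ (suc n)) →
    ∀ n → n ≤ N → e n ≡ e′ n
  recurrence-determines N c e e′ e₀ rec rec′ = <-rec (λ n → n ≤ N → e n ≡ e′ n) step
    where
    step : ∀ n → (∀ {m} → m < n → m ≤ N → e m ≡ e′ m) → n ≤ N → e n ≡ e′ n
    step zero    _  _   = e₀
    step (suc n) ih n<N = begin
      e (suc n)            ≡⟨ rec n n<N ⟩
      - conv c e (suc n)   ≡⟨ cong -_ (conv-cong< c (suc n) (λ m m<n → ih m<n (ℕₚ.≤-trans (ℕₚ.<⇒≤ m<n) n<N))) ⟩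
      - conv c e′ (suc n)  ≡⟨ sym (rec′ n) ⟩
      e′ (suc n)           ∎

module SignedCompositions where

  open import Data.Nat as ℕ using (_≤_; _∸_; _!; _<ᵇ_; _≡ᵇ_; NonZero)
  import Data.Nat.Properties as ℕₚ
  open import Data.Integer using (ℤ; +_; 0ℤ; -1ℤ; _+_; _*_; -_)
  open import Data.Integer.Properties
    using (+-*-semiring; +-identityʳ; *-identityˡ; *-zeroʳ; *-assoc; -1*i≡-i)
  open import Data.Bool using (true; false; _∧_; not)
  open import Data.Fin using (Fin; toℕ)
  open import Data.Vec using (Vec; _∷_; lookup; replicate)
  open import Data.Empty using (⊥-elim)
  import Algebra.Properties.Semiring.Sum ℕₚ.+-*-semiring as ℕΣ
  open import Algebra.Properties.Semiring.Sum +-*-semiring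
    using (sum-syntax; sum-cong-≗; *-distribˡ-sum) renaming (sum to ∑)
  open import Relation.Binary.PropositionalEquality
  open ≡-Reasoning
  open import Defs using (LHS; summand; numBlocks)
  open BlockTypes
  open TupleSums
  open Convolution
  open Admissible
  open DefsBridge using (LHS-as-∑box)
  open SummandArithmetic using (weight-zero)
  open Summand

  signedCount : (L B j n : ℕ) → ℤ
  signedCount L B j n = ∑box L B (λ b → onlyIf (admissible j n b) (signedMultinomial b))

  -- Only the zero tuple has weight 0.
  ∑box-weight-zero : ∀ L B j o (F : Vec ℕ L → ℤ) →
    ∑box L B (λ b → onlyIf ((weightFrom o b ≡ᵇ 0) ∧ partsAtMost j o b) (F b)) ≡ F (replicate L 0)
  ∑box-weight-zero zero    B j o F = refl
  ∑box-weight-zero (suc L) B j o F =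
    trans (cong₂ _+_ zeroFirst (trans (∑<-cong B (λ _ → ∑box-zero L B)) (∑<-zero B))) (+-identityʳ _)
    where
    zeroFirst : ∑box L B (λ b → onlyIf ((weightFrom o (0 ∷ b) ≡ᵇ 0) ∧ partsAtMost j o (0 ∷ b)) (F (0 ∷ b)))
              ≡ F (replicate (suc L) 0)
    zeroFirst rewrite ℕₚ.*-zeroʳ o with j <ᵇ suc o
    ... | true  = ∑box-weight-zero L B j (suc o) (λ b → F (0 ∷ b))
    ... | false = ∑box-weight-zero L B j (suc o) (λ b → F (0 ∷ b))

  numBlocks-replicate : ∀ L → numBlocks (replicate L 0) ≡ 0
  numBlocks-replicate zero    = refl
  numBlocks-replicate (suc L) = numBlocks-replicate L

  multinomial-replicate : ∀ L → multinomial (replicate L 0) ≡ 1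
  multinomial-replicate zero    = refl
  multinomial-replicate (suc L) = trans (ℕₚ.+-identityʳ _) (multinomial-replicate L)

  signedCount-zero : ∀ L B j → signedCount L B j 0 ≡ + 1
  signedCount-zero L B j = trans (∑box-weight-zero L B j 0 signedMultinomial)
    (cong₂ (λ m M → sign m * + M) (numBlocks-replicate L) (multinomial-replicate L))

  -- Pascal's rule with signs: removing the last part flips the sign.
  signed-pascal : ∀ {L} (a : Vec ℕ L) → .{{NonZero (numBlocks a)}} →
    signedMultinomial a ≡ ∑[ i < L ] ifPositive 0ℤ (lookup a i) (-1ℤ * signedMultinomial (remove i a))
  signed-pascal {L} a = begin
    sign (numBlocks a) * + multinomial a
      ≡⟨ cong (λ M → sign (numBlocks a) * + M) (pascal a) ⟩
    sign (numBlocks a) * + ℕΣ.sum {L} (λ i → ifPositive 0 (lookup a i) (multinomial (remove i a)))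
      ≡⟨ cong (sign (numBlocks a) *_) (+-∑ {L} _) ⟩
    sign (numBlocks a) * ∑[ i < L ] (+ ifPositive 0 (lookup a i) (multinomial (remove i a)))
      ≡⟨ *-distribˡ-sum {L} (sign (numBlocks a)) _ ⟩
    ∑[ i < L ] (sign (numBlocks a) * + ifPositive 0 (lookup a i) (multinomial (remove i a)))
      ≡⟨ sum-cong-≗ {L} term ⟩
    ∑[ i < L ] ifPositive 0ℤ (lookup a i) (-1ℤ * signedMultinomial (remove i a)) ∎
    where
    term : ∀ i → sign (numBlocks a) * + ifPositive 0 (lookup a i) (multinomial (remove i a))
               ≡ ifPositive 0ℤ (lookup a i) (-1ℤ * signedMultinomial (remove i a))
    term i with lookup a i in aᵢ
    ... | zero  = *-zeroʳ (sign (numBlocks a))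
    ... | suc u = trans (cong (λ m → sign m * + multinomial (remove i a)) (sym (numBlocks-remove i a aᵢ)))
                        (*-assoc -1ℤ (sign (numBlocks (remove i a))) (+ multinomial (remove i a)))

  blocks-nonZero : ∀ {L} n (a : Vec ℕ L) → weightFrom 0 a ≡ suc n → NonZero (numBlocks a)
  blocks-nonZero n a w≡ with numBlocks a in m≡
  ... | zero  = ⊥-elim (ℕₚ.0≢1+n (trans (sym (weight-zero 0 a m≡)) w≡))
  ... | suc _ = _

  ∑-fitting : ∀ j n L → n ≤ L → (g : ℕ → ℤ) →
    ∑[ i < L ] onlyIf (fits j n (blockSize 0 i)) (g (blockSize 0 i))
      ≡ ∑< n (λ p → onlyIf (not (j <ᵇ suc p)) (g (suc p)))
  ∑-fitting j n L n≤L g = begin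
    ∑[ i < L ] onlyIf (fits j n (blockSize 0 i)) (g (blockSize 0 i))
      ≡⟨ sum-cong-≗ {L} (λ i → cong (λ s → onlyIf (fits j n s) (g s)) (blockSize-toℕ 0 i)) ⟩
    ∑< L (λ p → onlyIf (fits j n (suc p)) (g (suc p)))
      ≡⟨ ∑<-cong L (λ p → onlyIf-∧ (not (n <ᵇ suc p)) (not (j <ᵇ suc p)) (g (suc p))) ⟩
    ∑< L (λ p → onlyIf (not (n <ᵇ suc p)) (onlyIf (not (j <ᵇ suc p)) (g (suc p))))
      ≡⟨ ∑<-truncate n≤L (λ p → onlyIf (not (j <ᵇ suc p)) (g (suc p))) ⟩
    ∑< n (λ p → onlyIf (not (j <ᵇ suc p)) (g (suc p))) ∎

  -- E(n) = - Σ_{s=1}^{min(j,n)} E(n-s) for 1 ≤ n ≤ L, B: sort compositions by their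
  -- last part.
  signedCount-recurrence : ∀ L B j n → suc n ≤ L → suc n ≤ B →
    signedCount L B j (suc n) ≡ - conv (partsUpTo j) (signedCount L B j) (suc n)
  signedCount-recurrence L B j n n<L n<B = begin
    ∑box L B (λ a → onlyIf (admissible j (suc n) a) (signedMultinomial a))
      ≡⟨ ∑box-cong L B (λ a → onlyIf-admissible j (suc n) a
                               (λ w≡ → signed-pascal a {{blocks-nonZero n a w≡}})) ⟩
    ∑box L B (λ a → onlyIf (admissible j (suc n) a)
                      (∑[ i < L ] ifPositive 0ℤ (lookup a i) (-1ℤ * signedMultinomial (remove i a))))
      ≡⟨ ∑-by-removed-block j (suc n) L B n<B (λ _ b → -1ℤ * signedMultinomial b) ⟩
    ∑[ i < L ] onlyIf (fits j (suc n) (blockSize 0 i))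
                 (∑box L B (λ b → onlyIf (admissible j (suc n ∸ blockSize 0 i) b) (-1ℤ * signedMultinomial b)))
      ≡⟨ sum-cong-≗ {L} (λ i → cong (onlyIf (fits j (suc n) (blockSize 0 i))) (negated (suc n ∸ blockSize 0 i))) ⟩
    ∑[ i < L ] onlyIf (fits j (suc n) (blockSize 0 i)) (-1ℤ * E (suc n ∸ blockSize 0 i))
      ≡⟨ ∑-fitting j (suc n) L n<L (λ s → -1ℤ * E (suc n ∸ s)) ⟩
    ∑< (suc n) (λ p → onlyIf (not (j <ᵇ suc p)) (-1ℤ * E (suc n ∸ suc p)))
      ≡⟨ ∑<-cong (suc n) (λ p → trans (onlyIf-*ˡ (not (j <ᵇ suc p)) -1ℤ _) (cong (-1ℤ *_) (as-coefficient p))) ⟩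
    ∑< (suc n) (λ p → -1ℤ * (partsUpTo j p * E (suc n ∸ suc p)))
      ≡⟨ sym (*-distribˡ-sum {suc n} -1ℤ (λ i → partsUpTo j (toℕ i) * E (suc n ∸ suc (toℕ i)))) ⟩
    -1ℤ * conv (partsUpTo j) E (suc n)
      ≡⟨ -1*i≡-i _ ⟩
    - conv (partsUpTo j) E (suc n) ∎
    where
    E = signedCount L B j
    negated : ∀ m → ∑box L B (λ b → onlyIf (admissible j m b) (-1ℤ * signedMultinomial b)) ≡ -1ℤ * E m
    negated m = trans (∑box-cong L B (λ b → onlyIf-*ˡ (admissible j m b) -1ℤ (signedMultinomial b)))
                      (∑box-*ˡ L B -1ℤ (λ b → onlyIf (admissible j m b) (signedMultinomial b)))
    as-coefficient : ∀ p → onlyIf (not (j <ᵇ suc p)) (E (suc n ∸ suc p)) ≡ partsUpTo j p * E (suc n ∸ suc p)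
    as-coefficient p = trans (cong (onlyIf (not (j <ᵇ suc p))) (sym (*-identityˡ _)))
                             (onlyIf-*ʳ (not (j <ᵇ suc p)) (+ 1) (E (suc n ∸ suc p)))

  LHS-as-convolution : ∀ k′ j →
    LHS (suc k′) j ≡ + (k′ !) * conv (weightedPartsUpTo j) (signedCount (suc k′) (suc k′) j) (suc k′)
  LHS-as-convolution k′ j = begin
    LHS k j
      ≡⟨ LHS-as-∑box k j ⟩
    ∑box k k (λ a → onlyIf (admissible j k a) (summand a))
      ≡⟨ ∑box-cong k k (λ a → trans (onlyIf-admissible j k a (summand-by-last-part a))
                                    (onlyIf-*ˡ (admissible j k a) (+ (k′ !)) _)) ⟩
    ∑box k k (λ a → + (k′ !) * onlyIf (admissible j k a) (∑[ i < k ] ifPositive 0ℤ (lookup a i) (G i (remove i a))))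
      ≡⟨ ∑box-*ˡ k k (+ (k′ !)) (λ a → onlyIf (admissible j k a) (∑[ i < k ] ifPositive 0ℤ (lookup a i) (G i (remove i a)))) ⟩
    + (k′ !) * ∑box k k (λ a → onlyIf (admissible j k a) (∑[ i < k ] ifPositive 0ℤ (lookup a i) (G i (remove i a))))
      ≡⟨ cong (+ (k′ !) *_) (∑-by-removed-block j k k k ℕₚ.≤-refl G) ⟩
    + (k′ !) * ∑[ i < k ] onlyIf (fits j k (blockSize 0 i))
                 (∑box k k (λ b → onlyIf (admissible j (k ∸ blockSize 0 i) b) (G i b)))
      ≡⟨ cong (+ (k′ !) *_) (sum-cong-≗ {k} (λ i → cong (onlyIf (fits j k (blockSize 0 i))) (weighted i))) ⟩
    + (k′ !) * ∑[ i < k ] onlyIf (fits j k (blockSize 0 i)) (+ blockSize 0 i * E (k ∸ blockSize 0 i))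
      ≡⟨ cong (+ (k′ !) *_) (∑-fitting j k k ℕₚ.≤-refl (λ s → + s * E (k ∸ s))) ⟩
    + (k′ !) * ∑< k (λ p → onlyIf (not (j <ᵇ suc p)) (+ suc p * E (k ∸ suc p)))
      ≡⟨ cong (+ (k′ !) *_) (∑<-cong k (λ p → onlyIf-*ʳ (not (j <ᵇ suc p)) (+ suc p) (E (k ∸ suc p)))) ⟩
    + (k′ !) * conv (weightedPartsUpTo j) E k ∎
    where
    k = suc k′
    E = signedCount k k j
    G : Fin k → Vec ℕ k → ℤ
    G i b = + blockSize 0 i * signedMultinomial b
    weighted : ∀ i → ∑box k k (λ b → onlyIf (admissible j (k ∸ blockSize 0 i) b) (G i b))
                   ≡ + blockSize 0 i * E (k ∸ blockSize 0 i)
    weighted i = trans (∑box-cong k k (λ b → onlyIf-*ˡ (admissible j (k ∸ blockSize 0 i) b) (+ blockSize 0 i) (signedMultinomial b)))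
                       (∑box-*ˡ k k (+ blockSize 0 i) (λ b → onlyIf (admissible j (k ∸ blockSize 0 i) b) (signedMultinomial b)))

-- The sequence ε with generating function (1 - x)/(1 - x^P) = 1/(1 + x + ⋯ + x^j),
-- P = j + 1: ε(0) = 1 and ε(n) = d(n) - d(n-1) where d(n) = [P ∣ n].  It satisfies the
-- recurrence of the signed composition counts, and its convolution with
-- x + 2x² + ⋯ + j x^j, i.e. x (1 + ⋯ + x^j)' ε(x), has coefficients 1 - P d(n).
module Periodic (j′ : ℕ) where

  open import Data.Nat as ℕ using (_≤_; _<_; _∸_; _<ᵇ_; _≡ᵇ_; s≤s; z≤n)
  import Data.Nat.Properties as ℕₚ
  open import Data.Nat.Divisibility using (_∣?_; _∣0; ∣m+n∣m⇒∣n; ∣m∣n⇒∣m+n; ∣-refl; ∣⇒≤)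
  open import Data.Integer using (ℤ; +_; _+_; _-_; _*_; -_)
  open import Data.Integer.Properties
    using (+-identityˡ; +-identityʳ; *-identityˡ; *-identityʳ; *-zeroʳ; neg-involutive)
  open import Data.Integer.Tactic.RingSolver using (solve-∀)
  open import Data.Bool using (true; false; if_then_else_; not; T)
  open import Data.Empty using (⊥-elim)
  open import Relation.Nullary using (Dec; yes; no; ¬_)
  open import Relation.Nullary.Decidable using (does)
  open import Relation.Binary.Definitions using (tri<; tri≈; tri>)
  open import Relation.Binary.PropositionalEquality
  open ≡-Reasoning
  open TupleSums using (onlyIf)
  open Convolution
  open Comparisons

  j = suc j′
  P = suc j

  indicator : {A : Set} → Dec A → ℤ
  indicator x = if does x then + 1 else + 0

  indicator-iff : {A B : Set} (x : Dec A) (y : Dec B) → (A → B) → (B → A) → indicator x ≡ indicator y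
  indicator-iff (yes _) (yes _) _   _   = refl
  indicator-iff (no  _) (no  _) _   _   = refl
  indicator-iff (yes a) (no ¬b) a→b _   = ⊥-elim (¬b (a→b a))
  indicator-iff (no ¬a) (yes b) _   b→a = ⊥-elim (¬a (b→a b))

  indicator-yes : {A : Set} (x : Dec A) → A → indicator x ≡ + 1
  indicator-yes (yes _) _ = refl
  indicator-yes (no ¬a) a = ⊥-elim (¬a a)

  indicator-no : {A : Set} (x : Dec A) → ¬ A → indicator x ≡ + 0
  indicator-no (yes a) ¬a = ⊥-elim (¬a a)
  indicator-no (no _)  _  = refl

  d : ℕ → ℤ
  d n = indicator (P ∣? n)

  ε : ℕ → ℤ
  ε zero    = + 1
  ε (suc n) = d (suc n) - d n

  d-periodic : ∀ n → d (P ℕ.+ n) ≡ d n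
  d-periodic n = indicator-iff (P ∣? (P ℕ.+ n)) (P ∣? n) (λ P∣ → ∣m+n∣m⇒∣n P∣ ∣-refl) (∣m∣n⇒∣m+n ∣-refl)

  d-zero : d 0 ≡ + 1
  d-zero = indicator-yes (P ∣? 0) (P ∣0)

  d-small : ∀ m → 0 < m → m < P → d m ≡ + 0
  d-small (suc m) _ m<P = indicator-no (P ∣? suc m) (λ P∣ → ℕₚ.<-irrefl refl (ℕₚ.<-≤-trans m<P (∣⇒≤ P∣)))

  ε-periodic : ∀ r → ε r ≡ ε (suc (j ℕ.+ r))
  ε-periodic zero = sym (begin
    d (P ℕ.+ 0) - d (j ℕ.+ 0) ≡⟨ cong₂ _-_ (d-periodic 0) (cong d (ℕₚ.+-identityʳ j)) ⟩
    d 0 - d j                 ≡⟨ cong₂ _-_ d-zero (d-small j (s≤s z≤n) (ℕₚ.n<1+n j)) ⟩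
    + 1                       ∎)
  ε-periodic (suc r) =
    sym (cong₂ _-_ (d-periodic (suc r)) (trans (cong d (ℕₚ.+-suc j r)) (d-periodic r)))

  edge : ℕ → ℤ
  edge p = onlyIf (p ≡ᵇ j′) (+ 1)

  -- Convolving ε with x^j: the result at n ≥ 1 is ε(n+1), by periodicity when j ≤ n,
  -- and because both vanish when 0 < n < j.
  conv-last-size : ∀ n → 0 < n → conv edge ε n ≡ ε (suc n)
  conv-last-size n 0<n = trans (conv-monomial j′ ε n) (shift n 0<n)
    where
    shift : ∀ n → 0 < n → onlyIf (j′ <ᵇ n) (ε (n ∸ j)) ≡ ε (suc n)
    shift n 0<n with j′ <ᵇ n in e
    ... | true  = trans (ε-periodic (n ∸ j)) (cong (λ m → ε (suc m)) (ℕₚ.m+[n∸m]≡n j≤n))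
      where
      j≤n : j ≤ n
      j≤n = ℕₚ.<ᵇ⇒< j′ n (subst T (sym e) _)
    ... | false = sym (cong₂ _-_ (d-small (suc n) (s≤s z≤n) (s≤s (s≤s n≤j′)))
                                 (d-small n 0<n (s≤s (ℕₚ.≤-trans n≤j′ (ℕₚ.n≤1+n j′)))))
      where
      n≤j′ : n ≤ j′
      n≤j′ = ℕₚ.≮⇒≥ (λ j′<n → subst T e (ℕₚ.<⇒<ᵇ j′<n))

  partsUpTo-shift : ∀ p → partsUpTo j p ≡ partsUpTo j (suc p) + edge p
  partsUpTo-shift p = split j (suc p)
    where
    split : ∀ i q → onlyIf (not (i <ᵇ q)) (+ 1) ≡ onlyIf (not (i <ᵇ suc q)) (+ 1) + onlyIf (q ≡ᵇ i) (+ 1)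
    split zero    zero    = refl
    split zero    (suc q) = refl
    split (suc i) zero    = refl
    split (suc i) (suc q) = split i q

  weightedPartsUpTo-shift : ∀ p → weightedPartsUpTo j (suc p) + + P * edge p
                                 ≡ weightedPartsUpTo j p + partsUpTo j p
  weightedPartsUpTo-shift p with ℕₚ.<-cmp j (suc p)
  ... | tri< j<s s≢j _
    rewrite <ᵇ-true j<s | <ᵇ-true (ℕₚ.m<n⇒m<1+n j<s) | ≡ᵇ-false (λ p≡j′ → s≢j (cong suc (sym p≡j′)))
    = trans (+-identityˡ _) (*-zeroʳ (+ P))
  ... | tri≈ _ refl _
    rewrite <ᵇ-false (ℕₚ.≤-refl {j}) | <ᵇ-true (ℕₚ.n<1+n j) | ≡ᵇ-refl j′
    = trans (+-identityˡ _) (trans (*-identityʳ (+ P)) (cong +_ (ℕₚ.+-comm 1 j)))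
  ... | tri> _ s≢j s<j
    rewrite <ᵇ-false (ℕₚ.<⇒≤ s<j) | <ᵇ-false s<j | ≡ᵇ-false (λ p≡j′ → s≢j (cong suc (sym p≡j′)))
    = trans (cong (_+_ (+ suc (suc p))) (*-zeroʳ (+ P)))
            (trans (+-identityʳ _) (cong +_ (ℕₚ.+-comm 1 (suc p))))

  -- ε(x) (x + ⋯ + x^j) = ε(x) (1 + ⋯ + x^j) - ε(x) = 1 - ε(x) at positive degrees.
  conv-partsUpTo : ∀ n → conv (partsUpTo j) ε (suc n) ≡ - ε (suc n)
  conv-partsUpTo zero = sym (cong -_ (cong₂ _-_ (d-small 1 (s≤s z≤n) (s≤s (s≤s z≤n))) d-zero))
  conv-partsUpTo (suc n) = begin
    + 1 * ε (suc n) + A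
      ≡⟨ cong (_+ A) (*-identityˡ (ε (suc n))) ⟩
    ε (suc n) + A
      ≡⟨ cancel (ε (suc n)) A B ⟩
    ε (suc n) + ((A + B) - B)
      ≡⟨ cong (λ x → ε (suc n) + (x - B)) (sym split) ⟩
    ε (suc n) + (conv (partsUpTo j) ε (suc n) - B)
      ≡⟨ cong₂ (λ x y → ε (suc n) + (x - y)) (conv-partsUpTo n) (conv-last-size (suc n) (s≤s z≤n)) ⟩
    ε (suc n) + (- ε (suc n) - ε (suc (suc n)))
      ≡⟨ collapse (ε (suc n)) (ε (suc (suc n))) ⟩
    - ε (suc (suc n)) ∎
    where
    A = conv (λ p → partsUpTo j (suc p)) ε (suc n)
    B = conv edge ε (suc n)
    split : conv (partsUpTo j) ε (suc n) ≡ A + B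
    split = trans (conv-cong ε (suc n) partsUpTo-shift) (conv-+ (λ p → partsUpTo j (suc p)) edge ε (suc n))
    cancel : ∀ e a b → e + a ≡ e + ((a + b) - b)
    cancel = solve-∀
    collapse : ∀ a b → a + (- a - b) ≡ - b
    collapse = solve-∀

  ε-recurrence : ∀ n → ε (suc n) ≡ - conv (partsUpTo j) ε (suc n)
  ε-recurrence n = sym (trans (cong -_ (conv-partsUpTo n)) (neg-involutive (ε (suc n))))

  -- ε(x) (x + 2x² + ⋯ + j x^j) = 1/(1-x) - P/(1-x^P), coefficientwise 1 - P d(n) for n ≥ 1.
  weighted-convolution : ∀ n → conv (weightedPartsUpTo j) ε (suc n) ≡ + 1 - + P * d (suc n)
  weighted-convolution zero =
    sym (trans (cong (λ x → + 1 - + P * x) (d-small 1 (s≤s z≤n) (s≤s (s≤s z≤n))))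
               (cong (λ x → + 1 - x) (*-zeroʳ (+ P))))
  weighted-convolution (suc n) = begin
    + 1 * ε (suc n) + A
      ≡⟨ cong (_+ A) (*-identityˡ (ε (suc n))) ⟩
    ε (suc n) + A
      ≡⟨ cancel (ε (suc n)) A (+ P * B) ⟩
    ε (suc n) + ((A + + P * B) - + P * B)
      ≡⟨ cong (λ x → ε (suc n) + (x - + P * B)) split ⟩
    ε (suc n) + ((conv (weightedPartsUpTo j) ε (suc n) + conv (partsUpTo j) ε (suc n)) - + P * B)
      ≡⟨ cong₃ (weighted-convolution n) (conv-partsUpTo n) (conv-last-size (suc n) (s≤s z≤n)) ⟩
    ε (suc n) + ((+ 1 - + P * d (suc n) + - ε (suc n)) - + P * ε (suc (suc n)))
      ≡⟨ telescope (d (suc (suc n))) (d (suc n)) (d n) (+ P) ⟩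
    + 1 - + P * d (suc (suc n)) ∎
    where
    A = conv (λ p → weightedPartsUpTo j (suc p)) ε (suc n)
    B = conv edge ε (suc n)
    split : A + + P * B ≡ conv (weightedPartsUpTo j) ε (suc n) + conv (partsUpTo j) ε (suc n)
    split = begin
      A + + P * B
        ≡⟨ cong (_+_ A) (sym (conv-*ˡ (+ P) edge ε (suc n))) ⟩
      A + conv (λ p → + P * edge p) ε (suc n)
        ≡⟨ sym (conv-+ (λ p → weightedPartsUpTo j (suc p)) (λ p → + P * edge p) ε (suc n)) ⟩
      conv (λ p → weightedPartsUpTo j (suc p) + + P * edge p) ε (suc n)
        ≡⟨ conv-cong ε (suc n) weightedPartsUpTo-shift ⟩
      conv (λ p → weightedPartsUpTo j p + partsUpTo j p) ε (suc n)
        ≡⟨ conv-+ (weightedPartsUpTo j) (partsUpTo j) ε (suc n) ⟩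
      conv (weightedPartsUpTo j) ε (suc n) + conv (partsUpTo j) ε (suc n) ∎
    cong₃ : ∀ {x x′ y y′ z z′} → x ≡ x′ → y ≡ y′ → z ≡ z′ →
      ε (suc n) + ((x + y) - + P * z) ≡ ε (suc n) + ((x′ + y′) - + P * z′)
    cong₃ refl refl refl = refl
    cancel : ∀ e a b → e + a ≡ e + ((a + b) - b)
    cancel = solve-∀
    telescope : ∀ d₂ d₁ d₀ p → (d₁ - d₀) + ((+ 1 - p * d₁ + - (d₁ - d₀)) - p * (d₂ - d₁)) ≡ + 1 - p * d₂
    telescope = solve-∀

open import Defs
open import Data.Nat using (ℕ; suc; _∸_; _!; NonZero; _≤_)
open import Data.Nat.Properties using (<⇒≤)
open import Data.Nat.Divisibility using (_∣?_)
open import Data.Integer using (ℤ; +_; _*_; _-_)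
open import Relation.Nullary.Decidable using (does)
open import Data.Bool using (if_then_else_)
open import Relation.Binary.PropositionalEquality using (_≡_; cong; module ≡-Reasoning)
open Convolution using (conv; conv-cong<; partsUpTo; weightedPartsUpTo; recurrence-determines)
open SignedCompositions using (signedCount; signedCount-zero; signedCount-recurrence; LHS-as-convolution)

lemma2p3 : (k j : ℕ) → .{{_ : NonZero k}} → .{{_ : NonZero j}} →
    LHS k j ≡ (+ ((k ∸ 1) !)) * (+ 1 - (+ (suc j)) * (if does (suc j ∣? k) then + 1 else + 0))
lemma2p3 (suc k′) (suc j′) = begin
  LHS k j
    ≡⟨ LHS-as-convolution k′ j ⟩
  + (k′ !) * conv (weightedPartsUpTo j) E k
    ≡⟨ cong (+ (k′ !) *_) (conv-cong< (weightedPartsUpTo j) k (λ m m<k → E≡ε m (<⇒≤ m<k))) ⟩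
  + (k′ !) * conv (weightedPartsUpTo j) ε k
    ≡⟨ cong (+ (k′ !) *_) (weighted-convolution k′) ⟩
  + (k′ !) * (+ 1 - + P * d k) ∎
  where
  open ≡-Reasoning
  open Periodic j′
  k = suc k′
  E = signedCount k k j
  -- E and ε both start at 1 and obey the same recurrence, so they agree up to k.
  E≡ε : ∀ n → n ≤ k → E n ≡ ε n
  E≡ε = recurrence-determines k (partsUpTo j) E ε (signedCount-zero k k j)
          (λ n n<k → signedCount-recurrence k k j n n<k n<k) ε-recurrence
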